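{- Let $a,b,c,d$ be four consecutive vertices of $bd(T)$ (consecutive along the boundary cycle of $T$). In any partition $P$ of $T$ it is impossible to have $a,c\in P_i$ and $b,d\in P_j$ with $i\neq j$.
   Context: $G_\Delta$ is the infinite triangular lattice; $T$ is an equilateral triangular subgraph of $G_\Delta$, and $bd(T)$ is the set of vertices of $T$ adjacent in $G_\Delta$ to a vertex outside $T$ (these form a cycle around $T$). A partition of $T$ is a partition of $V(T)$ into three labelled districts $P_1,P_2,P_3$, each simply connected (induced subgraph connected, and no cycle of $G_\Delta$ made of its vertices encloses a vertex not in it). -}

module Defs where

open import Data.Nat as ℕ using (ℕ; zero; suc; _<ᵇ_; _∸_; _%_)
open import Data.Integer as ℤ using (ℤ; +_; ∣_∣)
open import Data.Bool using (if_then_else_)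
open import Data.Fin using (Fin)
open import Data.Product using (_×_; _,_; proj₁; proj₂; ∃; ∃-syntax)
open import Data.Empty using (⊥)
open import Data.List using (List; []; _∷_; length)
open import Data.List.Membership.Propositional using (_∈_; _∉_)
open import Data.List.Relation.Unary.All using (All)
open import Data.List.Relation.Unary.Unique.Propositional using (Unique)
open import Relation.Binary.PropositionalEquality using (_≡_)
open import Relation.Nullary using (¬_)

-- The infinite triangular lattice G_Δ.
-- Vertices are ℤ × ℤ (lattice coordinates w.r.t. two unit vectors at 60°);
-- (x , y) is adjacent to (x±1 , y), (x , y±1), (x+1 , y-1), (x-1 , y+1).

V : Set
V = ℤ × ℤ

data Dir : Set where
  d1 d2 d3 d4 d5 d6 : Dir

shift : Dir → V → V
shift d1 (x , y) = (x ℤ.+ ℤ.1ℤ , y)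
shift d2 (x , y) = (x ℤ.- ℤ.1ℤ , y)
shift d3 (x , y) = (x , y ℤ.+ ℤ.1ℤ)
shift d4 (x , y) = (x , y ℤ.- ℤ.1ℤ)
shift d5 (x , y) = (x ℤ.+ ℤ.1ℤ , y ℤ.- ℤ.1ℤ)
shift d6 (x , y) = (x ℤ.- ℤ.1ℤ , y ℤ.+ ℤ.1ℤ)

Adj : V → V → Set
Adj u v = ∃[ d ] shift d u ≡ v

data Reach (S : V → Set) : V → V → Set where
  here : ∀ {u} → S u → Reach S u u
  step : ∀ {u w v} → S u → Adj u w → Reach S w v → Reach S u v

Connected : (V → Set) → Set
Connected S = (∃[ v ] S v) × (∀ u v → S u → S v → Reach S u v)

Linked : V → List V → V → Set
Linked u []       w = Adj u w
Linked u (x ∷ xs) w = Adj u x × Linked x xs w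

IsCycle : List V → Set
IsCycle []       = ⊥
IsCycle (v ∷ vs) = (3 ℕ.≤ length (v ∷ vs)) × Unique (v ∷ vs) × Linked v vs v

-- A cycle C encloses a vertex v: v is not on C and v cannot escape to
-- infinity in G_Δ without passing through a vertex of C, i.e. every walk
-- from v avoiding C stays in a bounded box.
Encloses : List V → V → Set
Encloses C v =
  v ∉ C ×
  ∃[ R ] (∀ w → Reach (λ u → u ∉ C) v w →
            (∣ proj₁ w ∣ ℕ.≤ R) × (∣ proj₂ w ∣ ℕ.≤ R))

SimplyConnected : (V → Set) → Set
SimplyConnected S =
  Connected S ×
  (∀ C → IsCycle C → All S C → ∀ v → ¬ S v → ¬ Encloses C v)

InT : ℕ → V → Set
InT n (x , y) = ∃[ a ] ∃[ b ] (x ≡ + a × y ≡ + b × a ℕ.+ b ℕ.≤ n)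

-- The boundary cycle bd(T) (n ≥ 1) has 3n vertices; bdVertex n k is its
-- (k mod 3n)-th vertex, walking (0,0) → (n,0) → (0,n) → (0,0):
--   i < n       : (i , 0)
--   n ≤ i < 2n  : (2n - i , i - n)
--   2n ≤ i < 3n : (0 , 3n - i)
bdAt : ℕ → ℕ → V
bdAt n i =
  if i <ᵇ n then (+ i , + 0)
  else if i <ᵇ (2 ℕ.* n) then (+ (2 ℕ.* n ∸ i) , + (i ∸ n))
  else (+ 0 , + (3 ℕ.* n ∸ i))

bdVertex : ℕ → ℕ → V
bdVertex zero    k = (+ 0 , + 0)
bdVertex (suc m) k = bdAt (suc m) (k % (3 ℕ.* suc m))

-- A partition of T into three labelled districts P₁ P₂ P₃: a labelling
-- of vertices by Fin 3 (values off T are irrelevant); district i is the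
-- set of vertices of T labelled i; each district must be simply connected.

District : ℕ → (V → Fin 3) → Fin 3 → V → Set
District n lab i v = InT n v × lab v ≡ i

IsPartition : ℕ → (V → Fin 3) → Set
IsPartition n lab = ∀ i → SimplyConnected (District n lab i)

-- Paths inside the districts P_i (from a to c) and P_j (from b to d) are
-- vertex-disjoint walks in T.  A rotation of T followed by a translation
-- brings a, b, c, d onto row 0 of the upper half-plane, or around the apex
-- of the wedge y ≥ 0, x + y ≤ 0, with T inside the region.  A short walk
-- outside the region closes a → c into a closed walk whose crossing parity
-- with a horizontal ray (a winding number mod 2) is 1 at b and 0 below the
-- region.  But the parity is constant along walks avoiding the closed walk,
-- and b → d continues outside the region to below it: contradiction.
module Submission where

open import Defs
open import Algebra.Bundles using (CommutativeRing)
open import Data.Bool using (Bool; true; false; _∧_; _∨_; not; _xor_)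
open import Data.Bool.Properties using (T-≡; xor-∧-commutativeRing; xor-same; xor-assoc; xor-identityʳ)
open import Data.Fin using (Fin)
open import Data.Integer as ℤ using (ℤ; +_; -[1+_]; 0ℤ; 1ℤ; -1ℤ; _-_; -≤+; -≤-; +≤+)
import Data.Integer.Properties as ℤₚ
open import Data.Integer.Tactic.RingSolver using (solve-∀)
import Data.Nat.Tactic.RingSolver as ℕ-solver
open import Data.Nat as ℕ using (ℕ; zero; suc; _+_; _≤_; _<_; _∸_; z≤n; s≤s)
import Data.Nat.Properties as ℕₚ
open import Data.Nat.DivMod using (_%_; [m+n]%n≡m%n; %-distribˡ-+; m%n%n≡m%n; m<n⇒m%n≡m; m%n<n)
open import Data.Product using (_×_; _,_; proj₁; proj₂; Σ-syntax)
open import Data.Sum using (_⊎_; inj₁; inj₂)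
open import Function using (_∘_)
open import Relation.Binary.PropositionalEquality
open import Relation.Nullary using (¬_; contradiction; yes; no)
open import Function.Bundles using (module Equivalence)

open import Algebra.Properties.CommutativeSemigroup
  (CommutativeRing.+-commutativeSemigroup xor-∧-commutativeRing) using (interchange)

isZero : ℤ → Bool
isZero (+ zero) = true
isZero _        = false

isMinusOne : ℤ → Bool
isMinusOne -[1+ zero ] = true
isMinusOne _           = false

nonNegative : ℤ → Bool
nonNegative (+ _)    = true
nonNegative -[1+ _ ] = false

positive : ℤ → Bool
positive (+ suc _) = true
positive _         = false

isOrigin : V → Bool
isOrigin (x , y) = isZero y ∧ isZero x

opposite : Dir → Dir
opposite d1 = d2
opposite d2 = d1
opposite d3 = d4
opposite d4 = d3
opposite d5 = d6
opposite d6 = d5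

_-ᵥ_ : V → V → V
(x , y) -ᵥ (a , b) = (x - a , y - b)

private
  +1-1 : ∀ x → x ℤ.+ 1ℤ - 1ℤ ≡ x
  +1-1 = solve-∀
  -1+1 : ∀ x → x - 1ℤ ℤ.+ 1ℤ ≡ x
  -1+1 = solve-∀
  +1-sub : ∀ x a → x ℤ.+ 1ℤ - a ≡ x - a ℤ.+ 1ℤ
  +1-sub = solve-∀
  -1-sub : ∀ x a → x - 1ℤ - a ≡ x - a - 1ℤ
  -1-sub = solve-∀
  sub-+1 : ∀ x a → x - (a ℤ.+ 1ℤ) ≡ x - a - 1ℤ
  sub-+1 = solve-∀
  sub--1 : ∀ x a → x - (a - 1ℤ) ≡ x - a ℤ.+ 1ℤ
  sub--1 = solve-∀

shift-opposite : ∀ d z → shift (opposite d) (shift d z) ≡ z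
shift-opposite d1 (x , y) = cong (_, y) (+1-1 x)
shift-opposite d2 (x , y) = cong (_, y) (-1+1 x)
shift-opposite d3 (x , y) = cong (x ,_) (+1-1 y)
shift-opposite d4 (x , y) = cong (x ,_) (-1+1 y)
shift-opposite d5 (x , y) = cong₂ _,_ (+1-1 x) (-1+1 y)
shift-opposite d6 (x , y) = cong₂ _,_ (-1+1 x) (+1-1 y)

shift-sub : ∀ d u v → shift d u -ᵥ v ≡ shift d (u -ᵥ v)
shift-sub d1 (x , y) (a , b) = cong (_, y - b) (+1-sub x a)
shift-sub d2 (x , y) (a , b) = cong (_, y - b) (-1-sub x a)
shift-sub d3 (x , y) (a , b) = cong (x - a ,_) (+1-sub y b)
shift-sub d4 (x , y) (a , b) = cong (x - a ,_) (-1-sub y b)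
shift-sub d5 (x , y) (a , b) = cong₂ _,_ (+1-sub x a) (-1-sub y b)
shift-sub d6 (x , y) (a , b) = cong₂ _,_ (-1-sub x a) (+1-sub y b)

sub-shift : ∀ d u v → u -ᵥ shift d v ≡ shift (opposite d) (u -ᵥ v)
sub-shift d1 (x , y) (a , b) = cong (_, y - b) (sub-+1 x a)
sub-shift d2 (x , y) (a , b) = cong (_, y - b) (sub--1 x a)
sub-shift d3 (x , y) (a , b) = cong (x - a ,_) (sub-+1 y b)
sub-shift d4 (x , y) (a , b) = cong (x - a ,_) (sub--1 y b)
sub-shift d5 (x , y) (a , b) = cong₂ _,_ (sub-+1 x a) (sub--1 y b)
sub-shift d6 (x , y) (a , b) = cong₂ _,_ (sub--1 x a) (sub-+1 y b)

isZero-sound : ∀ k → isZero k ≡ true → k ≡ 0ℤ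
isZero-sound (+ zero) _ = refl

isOrigin-sub : ∀ u v → u ≢ v → isOrigin (u -ᵥ v) ≡ false
isOrigin-sub (x , y) (a , b) u≢v with isZero (y - b) in y≡b | isZero (x - a) in x≡a
... | false | _     = refl
... | true  | false = refl
... | true  | true  = contradiction (cong₂ _,_ (equal x a x≡a) (equal y b y≡b)) u≢v
  where
  equal : ∀ i j → isZero (i - j) ≡ true → i ≡ j
  equal i j eq = ℤₚ.i-j≡0⇒i≡j i j (isZero-sound (i - j) eq)

data Walk : V → V → Set where
  []  : ∀ {u} → Walk u u
  _∷_ : ∀ {u v} (d : Dir) → Walk (shift d u) v → Walk u v

infixr 5 _∷_ _++_

_++_ : ∀ {u v w} → Walk u v → Walk v w → Walk u w
[]      ++ κ = κ
(d ∷ γ) ++ κ = d ∷ (γ ++ κ)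

AllOn : (V → Set) → ∀ {u v} → Walk u v → Set
AllOn S {u} []      = S u
AllOn S {u} (_ ∷ γ) = S u × AllOn S γ

Avoids : ∀ {u v} → Walk u v → V → Set
Avoids γ z = AllOn (_≢ z) γ

module _ {S : V → Set} where

  AllOn-head : ∀ {u v} (γ : Walk u v) → AllOn S γ → S u
  AllOn-head []      s       = s
  AllOn-head (_ ∷ _) (s , _) = s

  AllOn-last : ∀ {u v} (γ : Walk u v) → AllOn S γ → S v
  AllOn-last []      s       = s
  AllOn-last (_ ∷ γ) (_ , s) = AllOn-last γ s

  AllOn-++ : ∀ {u v w} (γ : Walk u v) (κ : Walk v w) → AllOn S γ → AllOn S κ → AllOn S (γ ++ κ)
  AllOn-++ []      κ _       t = t
  AllOn-++ (_ ∷ γ) κ (s , r) t = s , AllOn-++ γ κ r t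

  AllOn-map : ∀ {S′ : V → Set} → (∀ {z} → S z → S′ z) → ∀ {u v} (γ : Walk u v) → AllOn S γ → AllOn S′ γ
  AllOn-map f []      s       = f s
  AllOn-map f (_ ∷ γ) (s , r) = f s , AllOn-map f γ r

AllOn-zip : ∀ {S S′ S″ : V → Set} → (∀ {z} → S z → S′ z → S″ z) →
            ∀ {u v} (γ : Walk u v) → AllOn S γ → AllOn S′ γ → AllOn S″ γ
AllOn-zip f []      s        t        = f s t
AllOn-zip f (_ ∷ γ) (s , ss) (t , ts) = f s t , AllOn-zip f γ ss ts

Reach⇒Walk : ∀ {S u v} → Reach S u v → Σ[ γ ∈ Walk u v ] AllOn S γ
Reach⇒Walk (here s) = [] , s
Reach⇒Walk (step s (d , refl) r) with Reach⇒Walk r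
... | γ , all = d ∷ γ , s , all

-- Crossing parity

-- The ray from the origin runs rightwards between rows 0 and -1: an edge
-- crosses it iff it joins these rows at a vertex (x , 0) with x ≥ 0.
crosses : V → Dir → Bool
crosses (x , y) d3 = isMinusOne y ∧ nonNegative x
crosses (x , y) d4 = isZero y ∧ nonNegative x
crosses (x , y) d5 = isZero y ∧ nonNegative x
crosses (x , y) d6 = isMinusOne y ∧ positive x
crosses _       d1 = false
crosses _       d2 = false

crossings : ∀ {u v} → Walk u v → V → Bool
crossings []              z = false
crossings (_∷_ {u} d γ) z = crosses (u -ᵥ z) d xor crossings γ z

crossings-++ : ∀ {u v w} (γ : Walk u v) (κ : Walk v w) z →
               crossings (γ ++ κ) z ≡ crossings γ z xor crossings κ z
crossings-++ []              κ z = refl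
crossings-++ (_∷_ {u} d γ) κ z =
  trans (cong (crosses (u -ᵥ z) d xor_) (crossings-++ γ κ z))
        (sym (xor-assoc (crosses (u -ᵥ z) d) (crossings γ z) (crossings κ z)))

-- For δ ∈ {d1, d3, d6}, the rays from the origin and from δ differ exactly
-- by the edges leaving the vertex set betweenRays δ, up to edges at 0 or δ.
betweenRays : Dir → V → Bool
betweenRays d1 _       = false
betweenRays _  (x , y) = isZero y ∧ nonNegative x

shiftCheck : Dir → V → Dir → Bool
shiftCheck δ p d =
  isOrigin p ∨ isOrigin (shift (opposite δ) p) ∨ isOrigin (shift d p) ∨ isOrigin (shift (opposite δ) (shift d p)) ∨
  not ((crosses p d xor crosses (shift (opposite δ) p) d) xor (betweenRays δ p xor betweenRays δ (shift d p)))

everyDir : (Dir → Bool) → Bool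
everyDir f = f d1 ∧ f d2 ∧ f d3 ∧ f d4 ∧ f d5 ∧ f d6

∧≡true⇒ : ∀ {a b} → a ∧ b ≡ true → a ≡ true × b ≡ true
∧≡true⇒ {true} {true} _ = refl , refl

everyDir-sound : ∀ f → everyDir f ≡ true → ∀ d → f d ≡ true
everyDir-sound f h with ∧≡true⇒ h
... | e₁ , h₁ with ∧≡true⇒ h₁
... | e₂ , h₂ with ∧≡true⇒ h₂
... | e₃ , h₃ with ∧≡true⇒ h₃
... | e₄ , h₄ with ∧≡true⇒ h₄
... | e₅ , e₆ = λ { d1 → e₁ ; d2 → e₂ ; d3 → e₃ ; d4 → e₄ ; d5 → e₅ ; d6 → e₆ }

-- shiftCheck δ p only inspects the coordinates of p near the origin, so
-- finitely many patterns decide it by evaluation.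
shiftCheck-d1 : ∀ p → everyDir (shiftCheck d1 p) ≡ true
shiftCheck-d1 (-[1+ _ ]            , -[1+ zero ]  ) = refl
shiftCheck-d1 (+ zero              , -[1+ zero ]  ) = refl
shiftCheck-d1 (+ suc zero          , -[1+ zero ]  ) = refl
shiftCheck-d1 (+ suc (suc zero)    , -[1+ zero ]  ) = refl
shiftCheck-d1 (+ suc (suc (suc _)) , -[1+ zero ]  ) = refl
shiftCheck-d1 (-[1+ _ ]            , -[1+ suc _ ] ) = refl
shiftCheck-d1 (+ _                 , -[1+ suc _ ] ) = refl
shiftCheck-d1 (-[1+ zero ]         , + zero       ) = refl
shiftCheck-d1 (-[1+ suc _ ]        , + zero       ) = refl
shiftCheck-d1 (+ zero              , + zero       ) = refl
shiftCheck-d1 (+ suc zero          , + zero       ) = refl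
shiftCheck-d1 (+ suc (suc zero)    , + zero       ) = refl
shiftCheck-d1 (+ suc (suc (suc _)) , + zero       ) = refl
shiftCheck-d1 (-[1+ zero ]         , + suc zero   ) = refl
shiftCheck-d1 (-[1+ suc _ ]        , + suc zero   ) = refl
shiftCheck-d1 (+ zero              , + suc zero   ) = refl
shiftCheck-d1 (+ suc zero          , + suc zero   ) = refl
shiftCheck-d1 (+ suc (suc _)       , + suc zero   ) = refl
shiftCheck-d1 (-[1+ _ ]            , + suc (suc _)) = refl
shiftCheck-d1 (+ _                 , + suc (suc _)) = refl

shiftCheck-d3 : ∀ p → everyDir (shiftCheck d3 p) ≡ true
shiftCheck-d3 (-[1+ _ ]      , -[1+ zero ]        ) = refl
shiftCheck-d3 (+ zero        , -[1+ zero ]        ) = refl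
shiftCheck-d3 (+ suc zero    , -[1+ zero ]        ) = refl
shiftCheck-d3 (+ suc (suc _) , -[1+ zero ]        ) = refl
shiftCheck-d3 (-[1+ _ ]      , -[1+ suc _ ]       ) = refl
shiftCheck-d3 (+ _           , -[1+ suc _ ]       ) = refl
shiftCheck-d3 (-[1+ zero ]   , + zero             ) = refl
shiftCheck-d3 (-[1+ suc _ ]  , + zero             ) = refl
shiftCheck-d3 (+ zero        , + zero             ) = refl
shiftCheck-d3 (+ suc zero    , + zero             ) = refl
shiftCheck-d3 (+ suc (suc _) , + zero             ) = refl
shiftCheck-d3 (-[1+ zero ]   , + suc zero         ) = refl
shiftCheck-d3 (-[1+ suc _ ]  , + suc zero         ) = refl
shiftCheck-d3 (+ zero        , + suc zero         ) = refl
shiftCheck-d3 (+ suc zero    , + suc zero         ) = refl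
shiftCheck-d3 (+ suc (suc _) , + suc zero         ) = refl
shiftCheck-d3 (-[1+ zero ]   , + suc (suc zero)   ) = refl
shiftCheck-d3 (-[1+ suc _ ]  , + suc (suc zero)   ) = refl
shiftCheck-d3 (+ zero        , + suc (suc zero)   ) = refl
shiftCheck-d3 (+ suc _       , + suc (suc zero)   ) = refl
shiftCheck-d3 (-[1+ _ ]      , + suc (suc (suc _))) = refl
shiftCheck-d3 (+ _           , + suc (suc (suc _))) = refl

shiftCheck-d6 : ∀ p → everyDir (shiftCheck d6 p) ≡ true
shiftCheck-d6 (-[1+ _ ]           , -[1+ zero ]        ) = refl
shiftCheck-d6 (+ zero             , -[1+ zero ]        ) = refl
shiftCheck-d6 (+ suc zero         , -[1+ zero ]        ) = refl
shiftCheck-d6 (+ suc (suc _)      , -[1+ zero ]        ) = refl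
shiftCheck-d6 (-[1+ _ ]           , -[1+ suc _ ]       ) = refl
shiftCheck-d6 (+ _                , -[1+ suc _ ]       ) = refl
shiftCheck-d6 (-[1+ zero ]        , + zero             ) = refl
shiftCheck-d6 (-[1+ suc _ ]       , + zero             ) = refl
shiftCheck-d6 (+ zero             , + zero             ) = refl
shiftCheck-d6 (+ suc zero         , + zero             ) = refl
shiftCheck-d6 (+ suc (suc _)      , + zero             ) = refl
shiftCheck-d6 (-[1+ zero ]        , + suc zero         ) = refl
shiftCheck-d6 (-[1+ suc zero ]    , + suc zero         ) = refl
shiftCheck-d6 (-[1+ suc (suc _) ] , + suc zero         ) = refl
shiftCheck-d6 (+ zero             , + suc zero         ) = refl
shiftCheck-d6 (+ suc zero         , + suc zero         ) = refl
shiftCheck-d6 (+ suc (suc _)      , + suc zero         ) = refl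
shiftCheck-d6 (-[1+ zero ]        , + suc (suc zero)   ) = refl
shiftCheck-d6 (-[1+ suc zero ]    , + suc (suc zero)   ) = refl
shiftCheck-d6 (-[1+ suc (suc _) ] , + suc (suc zero)   ) = refl
shiftCheck-d6 (+ zero             , + suc (suc zero)   ) = refl
shiftCheck-d6 (+ suc _            , + suc (suc zero)   ) = refl
shiftCheck-d6 (-[1+ _ ]           , + suc (suc (suc _))) = refl
shiftCheck-d6 (+ _                , + suc (suc (suc _))) = refl

ShiftInvariant : Dir → Set
ShiftInvariant δ = ∀ p d → shiftCheck δ p d ≡ true

shiftInvariant-d1 : ShiftInvariant d1
shiftInvariant-d1 p = everyDir-sound _ (shiftCheck-d1 p)

shiftInvariant-d3 : ShiftInvariant d3
shiftInvariant-d3 p = everyDir-sound _ (shiftCheck-d3 p)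

shiftInvariant-d6 : ShiftInvariant d6
shiftInvariant-d6 p = everyDir-sound _ (shiftCheck-d6 p)

only-last : ∀ {a b c e} x → a ∨ b ∨ c ∨ e ∨ not x ≡ true →
            a ≡ false → b ≡ false → c ≡ false → e ≡ false → x ≡ false
only-last false _ refl refl refl refl = refl

xor≡false⇒≡ : ∀ a b → a xor b ≡ false → a ≡ b
xor≡false⇒≡ false false _ = refl
xor≡false⇒≡ true  true  _ = refl

xor-cancelᵐ : ∀ p q r → (p xor q) xor (q xor r) ≡ p xor r
xor-cancelᵐ p q r = begin
  (p xor q) xor (q xor r) ≡⟨ xor-assoc p q (q xor r) ⟩
  p xor (q xor (q xor r)) ≡⟨ cong (p xor_) (sym (xor-assoc q q r)) ⟩
  p xor ((q xor q) xor r) ≡⟨ cong (λ t → p xor (t xor r)) (xor-same q) ⟩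
  p xor r                 ∎
  where open ≡-Reasoning

crosses-shift : ∀ δ → ShiftInvariant δ → ∀ u v d →
                u ≢ v → u ≢ shift δ v → shift d u ≢ v → shift d u ≢ shift δ v →
                crosses (u -ᵥ v) d xor crosses (u -ᵥ shift δ v) d
                  ≡ betweenRays δ (u -ᵥ v) xor betweenRays δ (shift d u -ᵥ v)
crosses-shift δ check u v d ne₁ ne₂ ne₃ ne₄ rewrite sub-shift δ u v | shift-sub d u v =
  xor≡false⇒≡ _ _ (only-last _ (check (u -ᵥ v) d) (isOrigin-sub u v ne₁) o₂ o₃ o₄)
  where
  o₂ : isOrigin (shift (opposite δ) (u -ᵥ v)) ≡ false
  o₂ = subst (λ q → isOrigin q ≡ false) (sub-shift δ u v) (isOrigin-sub u (shift δ v) ne₂)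
  o₃ : isOrigin (shift d (u -ᵥ v)) ≡ false
  o₃ = subst (λ q → isOrigin q ≡ false) (shift-sub d u v) (isOrigin-sub (shift d u) v ne₃)
  o₄ : isOrigin (shift (opposite δ) (shift d (u -ᵥ v))) ≡ false
  o₄ = subst (λ q → isOrigin q ≡ false)
             (trans (sub-shift δ (shift d u) v) (cong (shift (opposite δ)) (shift-sub d u v)))
             (isOrigin-sub (shift d u) (shift δ v) ne₄)

crossings-shift : ∀ δ → ShiftInvariant δ → ∀ {u w} (γ : Walk u w) v → Avoids γ v → Avoids γ (shift δ v) →
                  crossings γ v xor crossings γ (shift δ v)
                    ≡ betweenRays δ (u -ᵥ v) xor betweenRays δ (w -ᵥ v)
crossings-shift δ check {u} [] v _ _ = sym (xor-same (betweenRays δ (u -ᵥ v)))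
crossings-shift δ check {u} {w} (d ∷ γ) v (ne₁ , a₁) (ne₂ , a₂) = begin
  (c₁ xor r₁) xor (c₂ xor r₂) ≡⟨ interchange c₁ r₁ c₂ r₂ ⟩
  (c₁ xor c₂) xor (r₁ xor r₂) ≡⟨ cong₂ _xor_ (crosses-shift δ check u v d ne₁ ne₂ (AllOn-head γ a₁) (AllOn-head γ a₂))
                                            (crossings-shift δ check γ v a₁ a₂) ⟩
  (B u xor B (shift d u)) xor (B (shift d u) xor B w) ≡⟨ xor-cancelᵐ (B u) (B (shift d u)) (B w) ⟩
  B u xor B w ∎
  where
  open ≡-Reasoning
  B : V → Bool
  B z = betweenRays δ (z -ᵥ v)
  c₁ c₂ r₁ r₂ : Bool
  c₁ = crosses (u -ᵥ v) d
  c₂ = crosses (u -ᵥ shift δ v) d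
  r₁ = crossings γ v
  r₂ = crossings γ (shift δ v)

crossings-shift-closed : ∀ δ → ShiftInvariant δ → ∀ {u} (γ : Walk u u) v → Avoids γ v → Avoids γ (shift δ v) →
                         crossings γ v ≡ crossings γ (shift δ v)
crossings-shift-closed δ check {u} γ v a₁ a₂ =
  xor≡false⇒≡ _ _ (trans (crossings-shift δ check γ v a₁ a₂) (xor-same (betweenRays δ (u -ᵥ v))))

crossings-step-back : ∀ {u} (γ : Walk u u) z d →
                      (Avoids γ (shift d z) → Avoids γ (shift (opposite d) (shift d z)) →
                         crossings γ (shift d z) ≡ crossings γ (shift (opposite d) (shift d z))) →
                      Avoids γ z → Avoids γ (shift d z) → crossings γ z ≡ crossings γ (shift d z)
crossings-step-back γ z d forward a₁ a₂ =
  sym (subst (λ q → Avoids γ q → crossings γ (shift d z) ≡ crossings γ q) (shift-opposite d z) (forward a₂) a₁)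

crossings-step : ∀ {u} (γ : Walk u u) z d → Avoids γ z → Avoids γ (shift d z) → crossings γ z ≡ crossings γ (shift d z)
crossings-step γ z d1 = crossings-shift-closed d1 shiftInvariant-d1 γ z
crossings-step γ z d3 = crossings-shift-closed d3 shiftInvariant-d3 γ z
crossings-step γ z d6 = crossings-shift-closed d6 shiftInvariant-d6 γ z
crossings-step γ z d2 = crossings-step-back γ z d2 (crossings-shift-closed d1 shiftInvariant-d1 γ (shift d2 z))
crossings-step γ z d4 = crossings-step-back γ z d4 (crossings-shift-closed d3 shiftInvariant-d3 γ (shift d4 z))
crossings-step γ z d5 = crossings-step-back γ z d5 (crossings-shift-closed d6 shiftInvariant-d6 γ (shift d5 z))

crossings-constant : ∀ {u} (γ : Walk u u) {b w} (κ : Walk b w) → AllOn (Avoids γ) κ → crossings γ b ≡ crossings γ w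
crossings-constant γ []      _       = refl
crossings-constant γ (d ∷ κ) (a , r) = trans (crossings-step γ _ d a (AllOn-head κ r)) (crossings-constant γ κ r)

-- Separation

crosses-above : ∀ p d → 0ℤ ℤ.≤ proj₂ p → 0ℤ ℤ.≤ proj₂ (shift d p) → crosses p d ≡ false
crosses-above (x , -[1+ _ ])  _  () _
crosses-above (x , + _)       d1 _  _ = refl
crosses-above (x , + _)       d2 _  _ = refl
crosses-above (x , + _)       d3 _  _ = refl
crosses-above (x , + zero)    d4 _  ()
crosses-above (x , + suc _)   d4 _  _ = refl
crosses-above (x , + zero)    d5 _  ()
crosses-above (x , + suc _)   d5 _  _ = refl
crosses-above (x , + _)       d6 _  _ = refl

crossings-above : ∀ {u w} (γ : Walk u w) z → AllOn (λ g → proj₂ z ℤ.≤ proj₂ g) γ → crossings γ z ≡ false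
crossings-above []              z _       = refl
crossings-above (_∷_ {u} d γ) z (h , r) rewrite crossings-above γ z r =
  trans (xor-identityʳ _) (crosses-above (u -ᵥ z) d (ℤₚ.i≤j⇒0≤j-i h) above)
  where
  above : 0ℤ ℤ.≤ proj₂ (shift d (u -ᵥ z))
  above = subst (λ q → 0ℤ ℤ.≤ proj₂ q) (shift-sub d u z) (ℤₚ.i≤j⇒0≤j-i (AllOn-head γ r))

DisjointLinks : (V → Set) → V → V → V → V → Set
DisjointLinks S a b c d =
  Σ[ P ∈ Walk a c ] Σ[ Q ∈ Walk b d ] AllOn S P × AllOn S Q × AllOn (Avoids P) Q

-- R closes P into a closed walk crossing the ray from b an odd number of
-- times, while κ carries d to row -1, where no ray is crossed.
separation : (inside : V → Bool) → (∀ z → inside z ≡ true → 0ℤ ℤ.≤ proj₂ z) →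
             ∀ {a b c d w} → proj₂ b ≡ 0ℤ → proj₂ w ≡ -1ℤ →
             (R : Walk c a) → crossings R b ≡ true → AllOn (λ g → -1ℤ ℤ.≤ proj₂ g) R →
             AllOn (λ g → inside g ≡ false ⊎ g ≡ a ⊎ g ≡ c) R →
             (κ : Walk d w) → AllOn (λ t → t ≡ d ⊎ inside t ≡ false × Avoids R t) κ →
             ¬ DisjointLinks (λ z → inside z ≡ true) a b c d
separation inside upper {a} {b} {c} {d} {w} b₀ w₋₁ R R-b R-low R-out κ κ-out (P , Q , P-in , Q-in , Q-avoids) =
  contradiction (trans (sym Γ-b) (trans (crossings-constant Γ (Q ++ κ) (AllOn-++ Q κ Q-avoidsΓ κ-avoidsΓ)) Γ-w)) λ ()
  where
  Γ : Walk a a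
  Γ = P ++ R

  P-upper : AllOn (λ g → 0ℤ ℤ.≤ proj₂ g) P
  P-upper = AllOn-map (upper _) P P-in

  Γ-b : crossings Γ b ≡ true
  Γ-b = trans (crossings-++ P R b)
              (cong₂ _xor_ (crossings-above P b (subst (λ y → AllOn (λ g → y ℤ.≤ proj₂ g) P) (sym b₀) P-upper)) R-b)

  Γ-w : crossings Γ w ≡ false
  Γ-w = crossings-above Γ w (subst (λ y → AllOn (λ g → y ℤ.≤ proj₂ g) Γ) (sym w₋₁)
          (AllOn-++ P R (AllOn-map (ℤₚ.≤-trans (-≤+ {0} {0})) P P-upper) R-low))

  separated : ∀ {g q} → inside g ≡ false → inside q ≡ true → g ≢ q
  separated g-out q-in refl = contradiction (trans (sym g-out) q-in) λ ()

  R-avoids : ∀ {q} → inside q ≡ true → Avoids P q → Avoids R q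
  R-avoids {q} q-in P-avoids = AllOn-map off R R-out
    where
    off : ∀ {g} → inside g ≡ false ⊎ g ≡ a ⊎ g ≡ c → g ≢ q
    off (inj₁ g-out)         = separated g-out q-in
    off (inj₂ (inj₁ refl)) = AllOn-head P P-avoids
    off (inj₂ (inj₂ refl)) = AllOn-last P P-avoids

  Q-avoidsΓ : AllOn (Avoids Γ) Q
  Q-avoidsΓ = AllOn-zip (λ q-in P-avoids → AllOn-++ P R P-avoids (R-avoids q-in P-avoids)) Q Q-in Q-avoids

  κ-avoidsΓ : AllOn (Avoids Γ) κ
  κ-avoidsΓ = AllOn-map avoid κ κ-out
    where
    avoid : ∀ {t} → t ≡ d ⊎ inside t ≡ false × Avoids R t → Avoids Γ t
    avoid (inj₁ refl)              = AllOn-last Q Q-avoidsΓ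
    avoid (inj₂ (t-out , R-avoid)) = AllOn-++ P R (AllOn-map (λ g-in → separated t-out g-in ∘ sym) P P-in) R-avoid

upperHalfPlane : V → Bool
upperHalfPlane (_ , y) = nonNegative y

wedge : V → Bool
wedge (x , y) = nonNegative y ∧ nonNegative (ℤ.- (x ℤ.+ y))

upperHalfPlane-upper : ∀ z → upperHalfPlane z ≡ true → 0ℤ ℤ.≤ proj₂ z
upperHalfPlane-upper (_ , + _) _ = +≤+ z≤n

wedge-upper : ∀ z → wedge z ≡ true → 0ℤ ℤ.≤ proj₂ z
wedge-upper (_ , + _) _ = +≤+ z≤n

no-links-on-row : ¬ DisjointLinks (λ z → upperHalfPlane z ≡ true) (-1ℤ , 0ℤ) (0ℤ , 0ℤ) (1ℤ , 0ℤ) (+ 2 , 0ℤ)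
no-links-on-row = separation upperHalfPlane upperHalfPlane-upper refl refl
  (d4 ∷ d2 ∷ d6 ∷ []) refl
  (-≤+ , -≤- z≤n , -≤- z≤n , -≤+)
  (inj₂ (inj₂ refl) , inj₁ refl , inj₁ refl , inj₂ (inj₁ refl))
  (d4 ∷ [])
  (inj₁ refl , inj₂ (refl , (λ ()) , (λ ()) , (λ ()) , (λ ())))

no-links-at-apex : ¬ DisjointLinks (λ z → wedge z ≡ true) (-[1+ 1 ] , 0ℤ) (-1ℤ , 0ℤ) (0ℤ , 0ℤ) (-1ℤ , 1ℤ)
no-links-at-apex = separation wedge wedge-upper refl refl
  (d4 ∷ d2 ∷ d6 ∷ []) refl
  (-≤+ , -≤- z≤n , -≤- z≤n , -≤+)
  (inj₂ (inj₂ refl) , inj₁ refl , inj₁ refl , inj₂ (inj₁ refl))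
  (d1 ∷ d5 ∷ d4 ∷ [])
  (inj₁ refl , inj₂ (refl , (λ ()) , (λ ()) , (λ ()) , (λ ())) , inj₂ (refl , (λ ()) , (λ ()) , (λ ()) , (λ ()))
             , inj₂ (refl , (λ ()) , (λ ()) , (λ ()) , (λ ())))

no-links-around-apex : ¬ DisjointLinks (λ z → wedge z ≡ true) (-1ℤ , 0ℤ) (0ℤ , 0ℤ) (-1ℤ , 1ℤ) (-[1+ 1 ] , + 2)
no-links-around-apex = separation wedge wedge-upper refl refl
  (d1 ∷ d5 ∷ d4 ∷ d2 ∷ d6 ∷ []) refl
  (-≤+ , -≤+ , -≤+ , -≤- z≤n , -≤- z≤n , -≤+)
  (inj₂ (inj₂ refl) , inj₁ refl , inj₁ refl , inj₁ refl , inj₁ refl , inj₂ (inj₁ refl))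
  (d1 ∷ d1 ∷ d5 ∷ d5 ∷ d4 ∷ [])
  (inj₁ refl , inj₂ (refl , (λ ()) , (λ ()) , (λ ()) , (λ ()) , (λ ()) , (λ ()))
             , inj₂ (refl , (λ ()) , (λ ()) , (λ ()) , (λ ()) , (λ ()) , (λ ()))
             , inj₂ (refl , (λ ()) , (λ ()) , (λ ()) , (λ ()) , (λ ()) , (λ ()))
             , inj₂ (refl , (λ ()) , (λ ()) , (λ ()) , (λ ()) , (λ ()) , (λ ()))
             , inj₂ (refl , (λ ()) , (λ ()) , (λ ()) , (λ ()) , (λ ()) , (λ ())))

-- Symmetries of the lattice

record Symmetry : Set where
  field
    act           : V → V
    actDir        : Dir → Dir
    act-shift     : ∀ d u → act (shift d u) ≡ shift (actDir d) (act u)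
    act-injective : ∀ {u v} → act u ≡ act v → u ≡ v

open Symmetry

idˢ : Symmetry
idˢ = record { act = λ u → u ; actDir = λ d → d ; act-shift = λ _ _ → refl ; act-injective = λ e → e }

_∘ˢ_ : Symmetry → Symmetry → Symmetry
A ∘ˢ B = record
  { act           = act A ∘ act B
  ; actDir        = actDir A ∘ actDir B
  ; act-shift     = λ d u → trans (cong (act A) (act-shift B d u)) (act-shift A (actDir B d) (act B u))
  ; act-injective = act-injective B ∘ act-injective A
  }

mapWalk : (A : Symmetry) → ∀ {u v} → Walk u v → Walk (act A u) (act A v)
mapWalk A []                  = []
mapWalk A {u} {v} (d ∷ γ) = actDir A d ∷ subst (λ z → Walk z (act A v)) (act-shift A d u) (mapWalk A γ)

AllOn-subst : ∀ {S : V → Set} {z z′ w} (e : z ≡ z′) (γ : Walk z w) → AllOn S γ → AllOn S (subst (λ q → Walk q w) e γ)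
AllOn-subst refl _ s = s

AllOn-mapWalk : (A : Symmetry) → ∀ {S S′ : V → Set} → (∀ {z} → S z → S′ (act A z)) →
                ∀ {u v} (γ : Walk u v) → AllOn S γ → AllOn S′ (mapWalk A γ)
AllOn-mapWalk A f []              s       = f s
AllOn-mapWalk A f (_∷_ {u} d γ) (s , r) = f s , AllOn-subst (act-shift A d u) (mapWalk A γ) (AllOn-mapWalk A f γ r)

DisjointLinks-map : (A : Symmetry) → ∀ {S S′ : V → Set} → (∀ {z} → S z → S′ (act A z)) →
                    ∀ {a b c d a′ b′ c′ d′} → act A a ≡ a′ → act A b ≡ b′ → act A c ≡ c′ → act A d ≡ d′ →
                    DisjointLinks S a b c d → DisjointLinks S′ a′ b′ c′ d′
DisjointLinks-map A f refl refl refl refl (P , Q , P-in , Q-in , Q-avoids) =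
  mapWalk A P , mapWalk A Q , AllOn-mapWalk A f P P-in , AllOn-mapWalk A f Q Q-in ,
  AllOn-mapWalk A (AllOn-mapWalk A (λ g≢q → g≢q ∘ act-injective A) P) Q Q-avoids

districts⇒DisjointLinks : ∀ {n lab i j a b c d} → i ≢ j →
                          Reach (District n lab i) a c → Reach (District n lab j) b d →
                          DisjointLinks (InT n) a b c d
districts⇒DisjointLinks {n} {lab} {i} {j} i≢j a↝c b↝d with Reach⇒Walk a↝c | Reach⇒Walk b↝d
... | P , P-in | Q , Q-in =
  P , Q , AllOn-map proj₁ P P-in , AllOn-map proj₁ Q Q-in ,
  AllOn-map (λ q-in → AllOn-map (λ p-in p≡q → i≢j (labels p-in q-in p≡q)) P P-in) Q Q-in
  where
  labels : ∀ {p q} → District n lab i p → District n lab j q → p ≡ q → i ≡ j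
  labels (_ , refl) (_ , refl) refl = refl

translation : V → Symmetry
translation o = record
  { act           = _-ᵥ o
  ; actDir        = λ d → d
  ; act-shift     = λ d u → shift-sub d u o
  ; act-injective = λ e → cong₂ _,_ (cancel (cong proj₁ e)) (cancel (cong proj₂ e))
  }
  where
  restore : ∀ x a → x ≡ x - a ℤ.+ a
  restore = solve-∀
  cancel : ∀ {x x′ a} → x - a ≡ x′ - a → x ≡ x′
  cancel {x} {x′} {a} e = trans (restore x a) (trans (cong (ℤ._+ a) e) (sym (restore x′ a)))

rotate : ℕ → V → V
rotate n (x , y) = (+ n - x - y , x)

rotateDir : Dir → Dir
rotateDir d1 = d6
rotateDir d2 = d5
rotateDir d3 = d2
rotateDir d4 = d1
rotateDir d5 = d3
rotateDir d6 = d4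

rotate-shift : ∀ n d u → rotate n (shift d u) ≡ shift (rotateDir d) (rotate n u)
rotate-shift n d1 (x , y) = cong (_, x ℤ.+ 1ℤ) (e₁ (+ n) x y)
  where e₁ : ∀ n x y → n - (x ℤ.+ 1ℤ) - y ≡ n - x - y - 1ℤ
        e₁ = solve-∀
rotate-shift n d2 (x , y) = cong (_, x - 1ℤ) (e₂ (+ n) x y)
  where e₂ : ∀ n x y → n - (x - 1ℤ) - y ≡ n - x - y ℤ.+ 1ℤ
        e₂ = solve-∀
rotate-shift n d3 (x , y) = cong (_, x) (e₃ (+ n) x y)
  where e₃ : ∀ n x y → n - x - (y ℤ.+ 1ℤ) ≡ n - x - y - 1ℤ
        e₃ = solve-∀
rotate-shift n d4 (x , y) = cong (_, x) (e₄ (+ n) x y)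
  where e₄ : ∀ n x y → n - x - (y - 1ℤ) ≡ n - x - y ℤ.+ 1ℤ
        e₄ = solve-∀
rotate-shift n d5 (x , y) = cong (_, x ℤ.+ 1ℤ) (e₅ (+ n) x y)
  where e₅ : ∀ n x y → n - (x ℤ.+ 1ℤ) - (y - 1ℤ) ≡ n - x - y
        e₅ = solve-∀
rotate-shift n d6 (x , y) = cong (_, x - 1ℤ) (e₆ (+ n) x y)
  where e₆ : ∀ n x y → n - (x - 1ℤ) - (y ℤ.+ 1ℤ) ≡ n - x - y
        e₆ = solve-∀

rotate-injective : ∀ n {u v} → rotate n u ≡ rotate n v → u ≡ v
rotate-injective n {x , y} {x′ , y′} e with cong proj₂ e
... | refl = cong (x ,_) (trans (restore (+ n) x y) (trans (cong (+ n - x -_) (cong proj₁ e)) (sym (restore (+ n) x y′))))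
  where
  restore : ∀ n x y → y ≡ n - x - (n - x - y)
  restore = solve-∀

rotation : ℕ → Symmetry
rotation n = record
  { act = rotate n ; actDir = rotateDir ; act-shift = rotate-shift n ; act-injective = rotate-injective n }

+[m∸n] : ∀ {m n} → n ≤ m → + (m ∸ n) ≡ + m - + n
+[m∸n] {m} {n} n≤m = sym (trans (ℤₚ.m-n≡m⊖n m n) (ℤₚ.⊖-≥ n≤m))

InT-rotate : ∀ n z → InT n z → InT n (rotate n z)
InT-rotate n _ (a , b , refl , refl , a+b≤n) =
  n ∸ (a + b) , a , trans (regroup (+ n) (+ a) (+ b)) (sym (trans (+[m∸n] a+b≤n) (cong (+ n -_) (ℤₚ.pos-+ a b)))) , refl ,
  ℕₚ.≤-trans (ℕₚ.+-monoʳ-≤ (n ∸ (a + b)) (ℕₚ.m≤m+n a b)) (ℕₚ.≤-reflexive (ℕₚ.m∸n+n≡m a+b≤n))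
  where
  regroup : ∀ n a b → n - a - b ≡ n - (a ℤ.+ b)
  regroup = solve-∀

InT⇒upperHalfPlane : ∀ n o {z} → InT n z → upperHalfPlane (z -ᵥ (o , 0ℤ)) ≡ true
InT⇒upperHalfPlane n o (a , b , refl , refl , _) = refl

InT⇒wedge : ∀ n {z} → InT n z → wedge (z -ᵥ (+ n , 0ℤ)) ≡ true
InT⇒wedge n (a , b , refl , refl , a+b≤n) =
  cong nonNegative (trans (regroup (+ n) (+ a) (+ b)) (trans (cong (+ n -_) (sym (ℤₚ.pos-+ a b))) (sym (+[m∸n] a+b≤n))))
  where
  regroup : ∀ n a b → ℤ.- (a - n ℤ.+ (b - 0ℤ)) ≡ n - (a ℤ.+ b)
  regroup = solve-∀

-- The boundary of T

<ᵇ-true : ∀ {x n} → x < n → (x ℕ.<ᵇ n) ≡ true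
<ᵇ-true x<n = Equivalence.to T-≡ (ℕₚ.<⇒<ᵇ x<n)

<ᵇ-false : ∀ {x n} → n ≤ x → (x ℕ.<ᵇ n) ≡ false
<ᵇ-false {x} {n} n≤x with x ℕ.<ᵇ n in eq
... | false = refl
... | true  = contradiction n≤x (ℕₚ.<⇒≱ (ℕₚ.<ᵇ⇒< x n (Equivalence.from T-≡ eq)))

bdAt-bottom : ∀ {n x} → x < n → bdAt n x ≡ (+ x , 0ℤ)
bdAt-bottom x<n rewrite <ᵇ-true x<n = refl

bdAt-right : ∀ {n s} → s < n → bdAt n (n + s) ≡ (+ (n ∸ s) , + s)
bdAt-right {n} {s} s<n
  rewrite <ᵇ-false (ℕₚ.m≤m+n n s) | <ᵇ-true (ℕₚ.+-monoʳ-< n (ℕₚ.<-≤-trans s<n (ℕₚ.m≤m+n n 0)))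
        | ℕₚ.[m+n]∸[m+o]≡n∸o n (n + 0) s | ℕₚ.+-identityʳ n | ℕₚ.m+n∸m≡n n s = refl

bdAt-left : ∀ {n s} → s < n → bdAt n (n + n + s) ≡ (+ 0 , + (n ∸ s))
bdAt-left {n} {s} s<n
  rewrite <ᵇ-false (ℕₚ.≤-trans (ℕₚ.m≤m+n n n) (ℕₚ.m≤m+n (n + n) s))
        | <ᵇ-false {n + n + s} {2 ℕ.* n} (subst (_≤ n + n + s) (cong (λ t → n + t) (sym (ℕₚ.+-identityʳ n))) (ℕₚ.m≤m+n (n + n) s))
        | ℕₚ.+-assoc n n s | ℕₚ.[m+n]∸[m+o]≡n∸o n (n + (n + 0)) (n + s)
        | ℕₚ.[m+n]∸[m+o]≡n∸o n (n + 0) s | ℕₚ.+-identityʳ n = refl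

thirds : ∀ n q → q < 3 ℕ.* n → q < n ⊎ (Σ[ s ∈ ℕ ] s < n × q ≡ n + s) ⊎ (Σ[ s ∈ ℕ ] s < n × q ≡ n + n + s)
thirds n q q<3n with q ℕ.<? n
... | yes q<n = inj₁ q<n
... | no q≮n with ℕₚ.m≤n⇒∃[o]m+o≡n (ℕₚ.≮⇒≥ q≮n)
... | o , refl with o ℕ.<? n
...   | yes o<n = inj₂ (inj₁ (o , o<n , refl))
...   | no o≮n with ℕₚ.m≤n⇒∃[o]m+o≡n (ℕₚ.≮⇒≥ o≮n)
...     | s , refl = inj₂ (inj₂ (s , s<n , sym (ℕₚ.+-assoc n n s)))
  where
  s<n : s < n
  s<n = subst (s <_) (ℕₚ.+-identityʳ n) (ℕₚ.+-cancelˡ-< n _ _ (ℕₚ.+-cancelˡ-< n _ _ q<3n))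

module _ (m : ℕ) where

  private
    N : ℕ
    N = suc m

  bdVertex-period : ∀ j → bdVertex N (j + 3 ℕ.* N) ≡ bdVertex N j
  bdVertex-period j = cong (bdAt N) ([m+n]%n≡m%n j (3 ℕ.* N))

  bdVertex-mod : ∀ k x → bdVertex N (k + x) ≡ bdVertex N (k % (3 ℕ.* N) + x)
  bdVertex-mod k x = cong (bdAt N) (begin
    (k + x) % M                ≡⟨ %-distribˡ-+ k x M ⟩
    (k % M + x % M) % M        ≡⟨ cong (λ t → (t + x % M) % M) (sym (m%n%n≡m%n k M)) ⟩
    (k % M % M + x % M) % M    ≡⟨ sym (%-distribˡ-+ (k % M) x M) ⟩
    (k % M + x) % M            ∎)
    where
    open ≡-Reasoning
    M : ℕ
    M = 3 ℕ.* N

  bdVertex-below : ∀ {j} → j < 3 ℕ.* N → bdVertex N j ≡ bdAt N j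
  bdVertex-below j<3N = cong (bdAt N) (m<n⇒m%n≡m j<3N)

  private
    N+N≤3N : N + N ≤ 3 ℕ.* N
    N+N≤3N = ℕₚ.+-monoʳ-≤ N (ℕₚ.m≤m+n N (N + 0))

    n-[n-s]-s≡0 : ∀ n s → n - (n - s) - s ≡ 0ℤ
    n-[n-s]-s≡0 = solve-∀

    n-0-[n-s]≡s : ∀ n s → n - 0ℤ - (n - s) ≡ s
    n-0-[n-s]≡s = solve-∀

    n+n+s≡n+s+n : ∀ n s → n + n + s ≡ n + s + n
    n+n+s≡n+s+n = ℕ-solver.solve-∀

    n+n+s+n≡s+3n : ∀ n s → n + n + s + n ≡ s + 3 ℕ.* n
    n+n+s+n≡s+3n = ℕ-solver.solve-∀

    n+s+x+n+n≡s+x+3n : ∀ n s x → n + s + x + n + n ≡ s + x + 3 ℕ.* n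
    n+s+x+n+n≡s+x+3n = ℕ-solver.solve-∀

    n+n+s+x+n≡s+x+3n : ∀ n s x → n + n + s + x + n ≡ s + x + 3 ℕ.* n
    n+n+s+x+n≡s+x+3n = ℕ-solver.solve-∀

    s+3≡1+[s+2] : ∀ s → s + 3 ≡ 1 + (s + 2)
    s+3≡1+[s+2] = ℕ-solver.solve-∀

    s+2≡1+[s+1] : ∀ s → s + 2 ≡ 1 + (s + 1)
    s+2≡1+[s+1] = ℕ-solver.solve-∀

    s+3≡2+[s+1] : ∀ s → s + 3 ≡ 2 + (s + 1)
    s+3≡2+[s+1] = ℕ-solver.solve-∀

    1+s+[2+o]≡s+3+o : ∀ s o → suc s + suc (suc o) ≡ s + 3 + o
    1+s+[2+o]≡s+3+o = ℕ-solver.solve-∀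

    [s+i]-[s+j]≡i-j : ∀ s i j → s ℤ.+ i - (s ℤ.+ j) ≡ i - j
    [s+i]-[s+j]≡i-j = solve-∀

    n-x-0-n≡-x : ∀ n x → n - x - 0ℤ - n ≡ ℤ.- x
    n-x-0-n≡-x = solve-∀

  rotate-bdAt : ∀ q → q < 3 ℕ.* N → rotate N (bdAt N q) ≡ bdVertex N (q + N)
  rotate-bdAt q q<3N with thirds N q q<3N
  ... | inj₁ q<N = begin
    rotate N (bdAt N q)     ≡⟨ cong (rotate N) (bdAt-bottom q<N) ⟩
    (+ N - + q - 0ℤ , + q)  ≡⟨ cong (_, + q) (trans (ℤₚ.+-identityʳ _) (sym (+[m∸n] (ℕₚ.<⇒≤ q<N)))) ⟩
    (+ (N ∸ q) , + q)       ≡⟨ sym (bdAt-right q<N) ⟩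
    bdAt N (N + q)          ≡⟨ cong (bdAt N) (ℕₚ.+-comm N q) ⟩
    bdAt N (q + N)          ≡⟨ sym (bdVertex-below (ℕₚ.<-≤-trans (ℕₚ.+-monoˡ-< N q<N) N+N≤3N)) ⟩
    bdVertex N (q + N)      ∎
    where open ≡-Reasoning
  ... | inj₂ (inj₁ (s , s<N , refl)) = begin
    rotate N (bdAt N (N + s))            ≡⟨ cong (rotate N) (bdAt-right s<N) ⟩
    (+ N - + (N ∸ s) - + s , + (N ∸ s))  ≡⟨ cong (_, + (N ∸ s)) (trans (cong (λ t → + N - t - + s) (+[m∸n] (ℕₚ.<⇒≤ s<N))) (n-[n-s]-s≡0 (+ N) (+ s))) ⟩
    (+ 0 , + (N ∸ s))                    ≡⟨ sym (bdAt-left s<N) ⟩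
    bdAt N (N + N + s)                   ≡⟨ cong (bdAt N) (n+n+s≡n+s+n N s) ⟩
    bdAt N (N + s + N)                   ≡⟨ sym (bdVertex-below N+s+N<3N) ⟩
    bdVertex N (N + s + N)               ∎
    where
    open ≡-Reasoning
    N+s+N<3N : N + s + N < 3 ℕ.* N
    N+s+N<3N = subst₂ _<_ (n+n+s≡n+s+n N s) (ℕₚ.+-assoc N N (N + 0)) (ℕₚ.+-monoʳ-< (N + N) (ℕₚ.<-≤-trans s<N (ℕₚ.m≤m+n N 0)))
  ... | inj₂ (inj₂ (s , s<N , refl)) = begin
    rotate N (bdAt N (N + N + s))        ≡⟨ cong (rotate N) (bdAt-left s<N) ⟩
    (+ N - + 0 - + (N ∸ s) , + 0)        ≡⟨ cong (_, + 0) (trans (cong (+ N - + 0 -_) (+[m∸n] (ℕₚ.<⇒≤ s<N))) (n-0-[n-s]≡s (+ N) (+ s))) ⟩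
    (+ s , + 0)                          ≡⟨ sym (bdAt-bottom s<N) ⟩
    bdAt N s                             ≡⟨ sym (bdVertex-below (ℕₚ.<-≤-trans s<N (ℕₚ.m≤m+n N _))) ⟩
    bdVertex N s                         ≡⟨ sym (bdVertex-period s) ⟩
    bdVertex N (s + 3 ℕ.* N)             ≡⟨ cong (bdVertex N) (sym (n+n+s+n≡s+3n N s)) ⟩
    bdVertex N (N + N + s + N)           ∎
    where open ≡-Reasoning

  rotate-boundary : ∀ k → rotate N (bdVertex N k) ≡ bdVertex N (k + N)
  rotate-boundary k = trans (rotate-bdAt (k % (3 ℕ.* N)) (m%n<n k (3 ℕ.* N))) (sym (bdVertex-mod k N))

  bdAt-InT : ∀ q → q < 3 ℕ.* N → InT N (bdAt N q)
  bdAt-InT q q<3N with thirds N q q<3N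
  ... | inj₁ q<N rewrite bdAt-bottom q<N =
    q , 0 , refl , refl , ℕₚ.≤-trans (ℕₚ.≤-reflexive (ℕₚ.+-identityʳ q)) (ℕₚ.<⇒≤ q<N)
  ... | inj₂ (inj₁ (s , s<N , refl)) rewrite bdAt-right s<N =
    N ∸ s , s , refl , refl , ℕₚ.≤-reflexive (ℕₚ.m∸n+n≡m (ℕₚ.<⇒≤ s<N))
  ... | inj₂ (inj₂ (s , s<N , refl)) rewrite bdAt-left s<N =
    0 , N ∸ s , refl , refl , ℕₚ.m∸n≤m N s

  bdVertex-InT : ∀ k → InT N (bdVertex N k)
  bdVertex-InT k = bdAt-InT (k % (3 ℕ.* N)) (m%n<n k (3 ℕ.* N))

  Normalisation : ℕ → Set
  Normalisation k = Σ[ A ∈ Symmetry ] Σ[ s ∈ ℕ ]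
    (∀ {z} → InT N z → InT N (act A z)) × s < N × (∀ x → act A (bdVertex N (k + x)) ≡ bdVertex N (s + x))

  normalise-below : ∀ q → q < 3 ℕ.* N → Normalisation q
  normalise-below q q<3N with thirds N q q<3N
  ... | inj₁ q<N = idˢ , q , (λ z∈T → z∈T) , q<N , λ _ → refl
  ... | inj₂ (inj₁ (s , s<N , refl)) =
    rotation N ∘ˢ rotation N , s , (λ {z} z∈T → InT-rotate N _ (InT-rotate N z z∈T)) , s<N , λ x → begin
      rotate N (rotate N (bdVertex N (N + s + x)))  ≡⟨ cong (rotate N) (rotate-boundary (N + s + x)) ⟩
      rotate N (bdVertex N (N + s + x + N))         ≡⟨ rotate-boundary (N + s + x + N) ⟩
      bdVertex N (N + s + x + N + N)                ≡⟨ cong (bdVertex N) (n+s+x+n+n≡s+x+3n N s x) ⟩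
      bdVertex N (s + x + 3 ℕ.* N)                  ≡⟨ bdVertex-period (s + x) ⟩
      bdVertex N (s + x)                            ∎
    where open ≡-Reasoning
  ... | inj₂ (inj₂ (s , s<N , refl)) =
    rotation N , s , (λ {z} → InT-rotate N z) , s<N , λ x → begin
      rotate N (bdVertex N (N + N + s + x))  ≡⟨ rotate-boundary (N + N + s + x) ⟩
      bdVertex N (N + N + s + x + N)         ≡⟨ cong (bdVertex N) (n+n+s+x+n≡s+x+3n N s x) ⟩
      bdVertex N (s + x + 3 ℕ.* N)           ≡⟨ bdVertex-period (s + x) ⟩
      bdVertex N (s + x)                     ∎
    where open ≡-Reasoning

  normalise : ∀ k → Normalisation k
  normalise k with normalise-below (k % (3 ℕ.* N)) (m%n<n k (3 ℕ.* N))
  ... | A , s , A-T , s<N , A-bd = A , s , A-T , s<N , λ x → trans (cong (act A) (bdVertex-mod k x)) (A-bd x)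

  bdVertex-bottom : ∀ {x} → x ≤ N → bdVertex N x ≡ (+ x , 0ℤ)
  bdVertex-bottom {x} x≤N with ℕₚ.m≤n⇒m<n∨m≡n x≤N
  ... | inj₁ x<N = trans (bdVertex-below (ℕₚ.<-≤-trans x<N (ℕₚ.m≤m+n N _))) (bdAt-bottom x<N)
  ... | inj₂ refl = trans (bdVertex-below (ℕₚ.m<m+n N (s≤s z≤n)))
                          (trans (cong (bdAt N) (sym (ℕₚ.+-identityʳ N))) (bdAt-right (s≤s z≤n)))

  bdVertex-pastCorner : ∀ {x} → x ≤ N → bdVertex N (x + N) ≡ rotate N (+ x , 0ℤ)
  bdVertex-pastCorner {x} x≤N = trans (sym (rotate-boundary x)) (cong (rotate N) (bdVertex-bottom x≤N))

  bottom-translated : ∀ s x j → s + x ≤ N → bdVertex N (s + x) -ᵥ (+ (s + j) , 0ℤ) ≡ (+ x - + j , 0ℤ)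
  bottom-translated s x j s+x≤N =
    trans (cong (_-ᵥ (+ (s + j) , 0ℤ)) (bdVertex-bottom s+x≤N))
          (cong (_, 0ℤ) (trans (cong₂ _-_ (ℤₚ.pos-+ s x) (ℤₚ.pos-+ s j)) ([s+i]-[s+j]≡i-j (+ s) (+ x) (+ j))))

  corner-translated : ∀ {x} → x ≤ N → bdVertex N (x + N) -ᵥ (+ N , 0ℤ) ≡ (ℤ.- + x , + x)
  corner-translated {x} x≤N = trans (cong (_-ᵥ (+ N , 0ℤ)) (bdVertex-pastCorner x≤N)) (cong₂ _,_ (n-x-0-n≡-x (+ N) (+ x)) (ℤₚ.+-identityʳ (+ x)))

  -- Writing k + 0 gives all four vertices the shape bdVertex N (k + x).
  BoundaryLinks : ℕ → Set
  BoundaryLinks k =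
    DisjointLinks (InT N) (bdVertex N (k + 0)) (bdVertex N (k + 1)) (bdVertex N (k + 2)) (bdVertex N (k + 3))

  no-links-along-side : ∀ s o → N ≡ s + 3 + o → ¬ BoundaryLinks s
  no-links-along-side s o N≡ = no-links-on-row ∘
    DisjointLinks-map (translation (+ (s + 1) , 0ℤ)) (InT⇒upperHalfPlane N (+ (s + 1)))
      (at z≤n) (at (s≤s z≤n)) (at (s≤s (s≤s z≤n))) (at ℕₚ.≤-refl)
    where
    at : ∀ {x} → x ≤ 3 → bdVertex N (s + x) -ᵥ (+ (s + 1) , 0ℤ) ≡ (+ x - + 1 , 0ℤ)
    at {x} x≤3 = bottom-translated s x 1 (ℕₚ.≤-trans (ℕₚ.+-monoʳ-≤ s x≤3) (subst (s + 3 ≤_) (sym N≡) (ℕₚ.m≤m+n (s + 3) o)))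

  no-links-before-corner : ∀ s → N ≡ s + 2 → ¬ BoundaryLinks s
  no-links-before-corner s N≡ = no-links-at-apex ∘
    DisjointLinks-map (translation (+ N , 0ℤ)) (InT⇒wedge N)
      (at z≤n) (at (s≤s z≤n)) (at ℕₚ.≤-refl)
      (trans (cong (λ t → bdVertex N t -ᵥ (+ N , 0ℤ)) (trans (s+3≡1+[s+2] s) (cong suc (sym N≡)))) (corner-translated 1≤N))
    where
    1≤N : 1 ≤ N
    1≤N = s≤s z≤n
    at : ∀ {x} → x ≤ 2 → bdVertex N (s + x) -ᵥ (+ N , 0ℤ) ≡ (+ x - + 2 , 0ℤ)
    at {x} x≤2 = subst (λ t → bdVertex N (s + x) -ᵥ (+ t , 0ℤ) ≡ (+ x - + 2 , 0ℤ)) (sym N≡)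
                       (bottom-translated s x 2 (subst (s + x ≤_) (sym N≡) (ℕₚ.+-monoʳ-≤ s x≤2)))

  no-links-across-corner : ∀ s → N ≡ s + 1 → 1 ≤ s → ¬ BoundaryLinks s
  no-links-across-corner s N≡ 1≤s = no-links-around-apex ∘
    DisjointLinks-map (translation (+ N , 0ℤ)) (InT⇒wedge N)
      (at z≤n) (at ℕₚ.≤-refl)
      (trans (cong (λ t → bdVertex N t -ᵥ (+ N , 0ℤ)) (trans (s+2≡1+[s+1] s) (cong suc (sym N≡)))) (corner-translated (s≤s z≤n)))
      (trans (cong (λ t → bdVertex N t -ᵥ (+ N , 0ℤ)) (trans (s+3≡2+[s+1] s) (cong (suc ∘ suc) (sym N≡)))) (corner-translated 2≤N))
    where
    2≤N : 2 ≤ N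
    2≤N = subst (2 ≤_) (trans (ℕₚ.+-comm 1 s) (sym N≡)) (s≤s 1≤s)
    at : ∀ {x} → x ≤ 1 → bdVertex N (s + x) -ᵥ (+ N , 0ℤ) ≡ (+ x - + 1 , 0ℤ)
    at {x} x≤1 = subst (λ t → bdVertex N (s + x) -ᵥ (+ t , 0ℤ) ≡ (+ x - + 1 , 0ℤ)) (sym N≡)
                       (bottom-translated s x 1 (subst (s + x ≤_) (sym N≡) (ℕₚ.+-monoʳ-≤ s x≤1)))

  no-standard-links : 2 ≤ N → ∀ s → s < N → ¬ BoundaryLinks s
  no-standard-links 2≤N s s<N with ℕₚ.m≤n⇒∃[o]m+o≡n s<N
  ... | zero , eq = no-links-across-corner s (trans (sym eq) (sym (ℕₚ.+-suc s 0)))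
                      (ℕₚ.≤-pred (subst (2 ≤_) (trans (sym eq) (cong suc (ℕₚ.+-identityʳ s))) 2≤N))
  ... | suc zero , eq = no-links-before-corner s (trans (sym eq) (sym (ℕₚ.+-suc s 1)))
  ... | suc (suc o) , eq = no-links-along-side s o (trans (sym eq) (1+s+[2+o]≡s+3+o s o))

  no-boundary-links : 2 ≤ N → ∀ k →
    ¬ DisjointLinks (InT N) (bdVertex N k) (bdVertex N (k + 1)) (bdVertex N (k + 2)) (bdVertex N (k + 3))
  no-boundary-links 2≤N k links with normalise k
  ... | A , s , A-T , s<N , A-bd = no-standard-links 2≤N s s<N
    (DisjointLinks-map A A-T (trans (cong (act A ∘ bdVertex N) (sym (ℕₚ.+-identityʳ k))) (A-bd 0)) (A-bd 1) (A-bd 2) (A-bd 3) links)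

lemma13 : (n : ℕ) → 1 ≤ n → (k : ℕ) → (lab : V → Fin 3) → IsPartition n lab →
          (i j : Fin 3) → i ≢ j →
          ¬ ((lab (bdVertex n k) ≡ i) × (lab (bdVertex n (k + 2)) ≡ i) ×
             (lab (bdVertex n (k + 1)) ≡ j) × (lab (bdVertex n (k + 3)) ≡ j))
-- For n = 1 the boundary has three vertices, so k and k + 3 name the same one.
lemma13 (suc zero) _ k lab _ i j i≢j (ℓa , _ , _ , ℓd) =
  i≢j (trans (sym ℓa) (trans (cong lab (sym (bdVertex-period 0 k))) ℓd))
lemma13 (suc (suc m)) _ k lab partition i j i≢j (ℓa , ℓc , ℓb , ℓd) =
  no-boundary-links (suc m) (s≤s (s≤s z≤n)) k
    (districts⇒DisjointLinks i≢j (connected i k (k + 2) ℓa ℓc) (connected j (k + 1) (k + 3) ℓb ℓd))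
  where
  connected : ∀ l x y → lab (bdVertex (suc (suc m)) x) ≡ l → lab (bdVertex (suc (suc m)) y) ≡ l →
              Reach (District (suc (suc m)) lab l) (bdVertex (suc (suc m)) x) (bdVertex (suc (suc m)) y)
  connected l x y ℓx ℓy =
    proj₂ (proj₁ (partition l)) _ _ (bdVertex-InT (suc m) x , ℓx) (bdVertex-InT (suc m) y , ℓy)
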